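{- A symmetric localized relation $\mathcal R$ is a weak bisimulation if and only if the following two properties hold: (1) if $(P,E,Q)\in\mathcal R$ and $P\xRightarrow[\lambda,\lambda_1,\lambda']{\widehat\Delta}P'$, then $Q\xRightarrow[\rho,\rho_1,\rho']{\widehat\Delta^c}Q'$ for some corresponding multiset $\widehat\Delta^c$ such that for every label $p:\alpha\cdot(\vec L)\in\widehat\Delta$ and its corresponding label $q:\alpha\cdot(\vec M)\in\widehat\Delta^c$ one has $(\lambda(p),\rho(q))\in E$, and $(P',E',Q')\in\mathcal R$ for some $E'\subseteq|P'|\times|Q'|$ such that $(p',q')\in E'$ implies $(\lambda\lambda_1\lambda'(p'),\rho\rho_1\rho'(q'))\in E$; (2) if $(P,E,Q)\in\mathcal R$ and $P\xrightarrow[\lambda]{\tau^*}P'$, then $Q\xrightarrow[\rho]{\tau^*}Q'$ and $(P',E',Q')\in\mathcal R$ for some $E'\subseteq|P'|\times|Q'|$ such that $(p',q')\in E'$ implies $(\lambda(p'),\rho(q'))\in E$.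
   Context: ${\sf Proc}$ is the set of data-closed canonical processes of value-passing CCS for trees; each $P\in{\sf Proc}$ has a finite set of locations $|P|$. Processes perform labelled transitions $P\xrightarrow[\lambda]{\delta}P'$ and multiset-labelled transitions $P\xrightarrow[\lambda]{\Delta}P'$, where $\delta$ is $\tau$ or a visible label $p:\alpha\cdot(\vec L)$ ($p$ a location, $\alpha$ an action $fv$ or $\overline fv$, $\vec L$ a vector of location sets), $\Delta$ a finite multiset of labels, and $\lambda:|P'|\to|P|$ a residual function. $P\xrightarrow[\lambda]{\tau^*}P'$: zero or more $\tau$-transitions with $\lambda$ the composition of their residuals. $\widehat\Delta$: $\Delta$ with all $\tau$ removed. $P\xRightarrow[\lambda,\lambda_1,\lambda']{\widehat\Delta}P'$: $P\xrightarrow[\lambda]{\tau^*}P_1\xrightarrow[\lambda_1]{\widehat\Delta}P_1'\xrightarrow[\lambda']{\tau^*}P'$. A corresponding multiset $\widehat\Delta^c$ of a multiset $\widehat\Delta$ of visible labels is one in bijection with it such that corresponding labels $p:\alpha\cdot(\vec L)$, $q:\alpha\cdot(\vec M)$ have the same action. A localized relation is a set of triples $(P,E,Q)$ with $P,Q\in{\sf Proc}$, $E\subseteq|P|\times|Q|$; symmetric if $(P,E,Q)\in\mathcal R\Rightarrow(Q,{}^tE,P)\in\mathcal R$. A symmetric localized relation $\mathcal S$ is a weak bisimulation if for $(P,E,Q)\in\mathcal S$: (i) $P\xrightarrow[\lambda]{\tau}P'$ implies $Q\xrightarrow[\rho]{\tau^*}Q'$ and $(P',E',Q')\in\mathcal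 S$ for some $E'$ with $(p',q')\in E'\Rightarrow(\lambda(p'),\rho(q'))\in E$; (ii) $P\xrightarrow[\lambda]{\widehat\Delta}P'$ implies $Q\xRightarrow[\rho,\rho_1,\rho']{\widehat\Delta^c}Q'$ such that each $p:\alpha\cdot(\vec L)\in\widehat\Delta$ corresponds to some $q:\alpha\cdot(\vec M)$ with $(p,\rho(q))\in E$, and $(P',E',Q')\in\mathcal S$ for some $E'$ with $(p',q')\in E'\Rightarrow(\lambda(p'),\rho\rho_1\rho'(q'))\in E$. -}

module Defs where

open import Level using (Level)
open import Data.Nat using (ℕ)
open import Data.Fin using (Fin)
open import Data.List using (List; length; lookup)
open import Data.Product using (Σ; Σ-syntax; ∃; _×_; _,_)
open import Function using (id; _∘_; flip)
open import Function.Bundles using (_⤖_; Bijection)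
open import Relation.Binary.PropositionalEquality using (_≡_)

-- An abstract "located" labelled transition system, capturing exactly the
-- structure of value-passing CCS for trees used in the lemma:
--   * Proc       : data-closed canonical processes
--   * Loc P      : the finite set |P| of locations of P
--   * Act        : actions  f v  /  f̄ v
--   * VisLab P   : visible labels  p : α · (L⃗)  of transitions out of P,
--                  with  loc ℓ = p ∈ |P|  and  act ℓ = α
--   * TauStep P P' λ  :  P ─τ→_λ P'      (λ : |P'| → |P|)
--   * MStep P P' Δ̂ λ  :  P ─Δ̂→_λ P'     (Δ̂ a finite multiset of visible labels,
--                                         represented as a list)
record LocLTS : Set₁ where
  field
    Proc     : Set
    Loc      : Proc → Set
    locFinite : (P : Proc) → Σ ℕ (λ n → Loc P ⤖ Fin n)
    Act      : Set
    VisLab   : Proc → Set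
    loc      : {P : Proc} → VisLab P → Loc P
    act      : {P : Proc} → VisLab P → Act
    TauStep  : (P P' : Proc) → (Loc P' → Loc P) → Set
    MStep    : (P P' : Proc) → List (VisLab P) → (Loc P' → Loc P) → Set

module _ (L : LocLTS) where
  open LocLTS L

  data TauStar : (P P' : Proc) → (Loc P' → Loc P) → Set where
    done : ∀ {P} → TauStar P P id
    step : ∀ {P P₁ P'} {λ₁ : Loc P₁ → Loc P} {μ : Loc P' → Loc P₁} →
           TauStep P P₁ λ₁ → TauStar P₁ P' μ → TauStar P P' (λ₁ ∘ μ)

  -- P ═Δ̂⇒_{λ,λ₁,λ'} P' :  P ─τ*→_λ P₁ ─Δ̂→_λ₁ P₁' ─τ*→_λ' P'
  record WeakTr (P P' : Proc) : Set where
    field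
      mid₁  : Proc
      mid₂  : Proc
      lab   : List (VisLab mid₁)
      res   : Loc mid₁ → Loc P
      res₁  : Loc mid₂ → Loc mid₁
      res'  : Loc P' → Loc mid₂
      pre   : TauStar P mid₁ res
      main  : MStep mid₁ mid₂ lab res₁
      post  : TauStar mid₂ P' res'

  LRel : Proc → Proc → Set₁
  LRel P Q = Loc P → Loc Q → Set

  LocRel : Set₁
  LocRel = (P Q : Proc) → LRel P Q → Set

  SymmetricLR : LocRel → Set₁
  SymmetricLR R = ∀ {P Q} {E : LRel P Q} → R P Q E → R Q P (flip E)

  CorrWith : {A B X Y : Proc} → List (VisLab A) → List (VisLab B) →
             (Loc A → Loc X) → (Loc B → Loc Y) → LRel X Y → Set
  CorrWith Δ Δc σ τ E =
    Σ (Fin (length Δ) ⤖ Fin (length Δc)) λ b →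
      ∀ i → act (lookup Δ i) ≡ act (lookup Δc (Bijection.to b i))
          × E (σ (loc (lookup Δ i))) (τ (loc (lookup Δc (Bijection.to b i))))

  WeakBisim : LocRel → Set₁
  WeakBisim R =
    SymmetricLR R ×
    (∀ {P Q} {E : LRel P Q} → R P Q E →
      (∀ {P'} {λ₀ : Loc P' → Loc P} → TauStep P P' λ₀ →
        Σ Proc λ Q' → Σ (Loc Q' → Loc Q) λ ρ → TauStar Q Q' ρ ×
        Σ (LRel P' Q') λ E' → R P' Q' E' ×
          (∀ p' q' → E' p' q' → E (λ₀ p') (ρ q')))
      ×
      (∀ {P'} {Δ : List (VisLab P)} {λ₀ : Loc P' → Loc P} → MStep P P' Δ λ₀ →
        Σ Proc λ Q' → Σ (WeakTr Q Q') λ w →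
          CorrWith Δ (WeakTr.lab w) id (WeakTr.res w) E ×
          Σ (LRel P' Q') λ E' → R P' Q' E' ×
            (∀ p' q' → E' p' q' →
               E (λ₀ p') (WeakTr.res w (WeakTr.res₁ w (WeakTr.res' w q'))))))

  WeakProp1 : LocRel → Set₁
  WeakProp1 R =
    ∀ {P Q} {E : LRel P Q} → R P Q E →
    ∀ {P'} (v : WeakTr P P') →
      Σ Proc λ Q' → Σ (WeakTr Q Q') λ w →
        CorrWith (WeakTr.lab v) (WeakTr.lab w) (WeakTr.res v) (WeakTr.res w) E ×
        Σ (LRel P' Q') λ E' → R P' Q' E' ×
          (∀ p' q' → E' p' q' →
             E (WeakTr.res v (WeakTr.res₁ v (WeakTr.res' v p')))
               (WeakTr.res w (WeakTr.res₁ w (WeakTr.res' w q'))))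

  WeakProp2 : LocRel → Set₁
  WeakProp2 R =
    ∀ {P Q} {E : LRel P Q} → R P Q E →
    ∀ {P'} {λ₀ : Loc P' → Loc P} → TauStar P P' λ₀ →
      Σ Proc λ Q' → Σ (Loc Q' → Loc Q) λ ρ → TauStar Q Q' ρ ×
      Σ (LRel P' Q') λ E' → R P' Q' E' ×
        (∀ p' q' → E' p' q' → E (λ₀ p') (ρ q'))

-- Weak transitions are closed under prefixing and suffixing τ*-runs, so a
-- τ*-run of P is matched by chaining the matches of its single τ-steps, and a
-- weak transition τ* Δ̂ τ* of P is matched by matching the two τ*-runs and
-- the multiset step separately and gluing the three answers of Q into one
-- weak transition. Conversely a τ-step is a τ*-run of length one and a
-- multiset step is a weak transition with empty τ*-runs.
module Submission where

open import Defs
open import Data.Product using (_×_; Σ; _,_; proj₁; proj₂)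
open import Data.List using (List)
open import Function using (id; _∘_)
open import Function.Bundles using (_⇔_; mk⇔)

module _ {L : LocLTS} where
  open LocLTS L

  _◅◅_ : ∀ {A B C} {f : Loc B → Loc A} {g : Loc C → Loc B} →
         TauStar L A B f → TauStar L B C g → TauStar L A C (f ∘ g)
  done     ◅◅ t = t
  step s r ◅◅ t = step s (r ◅◅ t)

  mStep⇒weakTr : ∀ {P P'} {Δ : List (VisLab P)} {λ₀ : Loc P' → Loc P} →
                 MStep P P' Δ λ₀ → WeakTr L P P'
  mStep⇒weakTr {Δ = Δ} {λ₀} m = record
    { lab = Δ ; res = id ; res₁ = λ₀ ; res' = id
    ; pre = done ; main = m ; post = done }

  wrapWeakTr : ∀ {P₀ P P' P''} {ρ : Loc P → Loc P₀} {ρ' : Loc P'' → Loc P'} →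
               TauStar L P₀ P ρ → WeakTr L P P' → TauStar L P' P'' ρ' →
               WeakTr L P₀ P''
  wrapWeakTr {ρ = ρ} {ρ'} t w t' = record
    { lab = lab ; res = ρ ∘ res ; res₁ = res₁ ; res' = res' ∘ ρ'
    ; pre = t ◅◅ pre ; main = main ; post = post ◅◅ t' }
    where open WeakTr w

  TauStepSim : (R : LocRel L) {P Q : Proc} → LRel L P Q → Set₁
  TauStepSim R {P} {Q} E =
    ∀ {P'} {λ₀ : Loc P' → Loc P} → TauStep P P' λ₀ →
      Σ Proc λ Q' → Σ (Loc Q' → Loc Q) λ ρ → TauStar L Q Q' ρ ×
      Σ (LRel L P' Q') λ E' → R P' Q' E' ×
        (∀ p' q' → E' p' q' → E (λ₀ p') (ρ q'))

  MStepSim : (R : LocRel L) {P Q : Proc} → LRel L P Q → Set₁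
  MStepSim R {P} {Q} E =
    ∀ {P'} {Δ : List (VisLab P)} {λ₀ : Loc P' → Loc P} → MStep P P' Δ λ₀ →
      Σ Proc λ Q' → Σ (WeakTr L Q Q') λ w →
        CorrWith L Δ (WeakTr.lab w) id (WeakTr.res w) E ×
        Σ (LRel L P' Q') λ E' → R P' Q' E' ×
          (∀ p' q' → E' p' q' →
             E (λ₀ p') (WeakTr.res w (WeakTr.res₁ w (WeakTr.res' w q'))))

  module _ (R : LocRel L) where

    weakProp2 : (∀ {P Q} {E : LRel L P Q} → R P Q E → TauStepSim R E) →
                WeakProp2 L R
    weakProp2 sim r done = _ , id , done , _ , r , λ _ _ e → e
    weakProp2 sim r (step s rest)
      with _ , ρ₁ , t₁ , _ , r₁ , h₁ ← sim r s
      with Q' , ρ₂ , t₂ , E' , r' , h₂ ← weakProp2 sim r₁ rest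
      = Q' , ρ₁ ∘ ρ₂ , t₁ ◅◅ t₂ , E' , r' , λ p q e → h₁ _ _ (h₂ p q e)

    weakProp1 : WeakProp2 L R →
                (∀ {P Q} {E : LRel L P Q} → R P Q E → MStepSim R E) →
                WeakProp1 L R
    weakProp1 prop2 sim r v
      with _ , ρ , t , _ , r₁ , h₁ ← prop2 r (WeakTr.pre v)
      with _ , w , (b , corr) , _ , r₂ , h₂ ← sim r₁ (WeakTr.main v)
      with Q' , ρ' , t' , E' , r' , h₃ ← prop2 r₂ (WeakTr.post v)
      = Q' , wrapWeakTr t w t' ,
        (b , λ i → proj₁ (corr i) , h₁ _ _ (proj₂ (corr i))) ,
        E' , r' , λ p q e → h₁ _ _ (h₂ _ _ (h₃ p q e))

lemma7 : (L : LocLTS) (R : LocRel L) → SymmetricLR L R →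
         (WeakBisim L R ⇔ (WeakProp1 L R × WeakProp2 L R))
lemma7 L R sym = mk⇔ toProps fromProps
  where
  toProps : WeakBisim L R → WeakProp1 L R × WeakProp2 L R
  toProps (_ , sim) = weakProp1 R prop2 (proj₂ ∘ sim) , prop2
    where
    prop2 : WeakProp2 L R
    prop2 = weakProp2 R (proj₁ ∘ sim)

  fromProps : WeakProp1 L R × WeakProp2 L R → WeakBisim L R
  fromProps (prop1 , prop2) =
    sym , λ r → (λ s → prop2 r (step s done)) , (λ m → prop1 r (mStep⇒weakTr m))
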